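{- Let $X=(X,\langle o,\partial\rangle)$ be a prechart, $R$ a bisimulation equivalence on $X$, and $(i,j)$ a splitting with $i\colon U\hookrightarrow X$ the inclusion of a subset $U\subseteq X$, $j\colon X\to U$, $j\circ i=\mathrm{id}_U$, and $\ker(j)\subseteq R$. Then $Q=R\cap(X\times U)$ is a bisimulation between $X$ and the rerouting $X[i,j]$.
   Context: Fix a finite set $A$. A prechart is $(X,\langle o,\partial\rangle)$ with $o\colon X\to2^A$, $\partial\colon X\to\mathcal P_\omega(X)^A$ ($\mathcal P_\omega$ = finite subsets), i.e. a coalgebra for $P(X)=2^A\times\mathcal P_\omega(X)^A$, $P(f)(o,h)(a)=(o(a),f[h(a)])$. Write $x\Rightarrow a$ for $o(x)(a)=1$, $x\xrightarrow{a}y$ for $y\in\partial(x)(a)$. A bisimulation between precharts $X,Y$ is $R\subseteq X\times Y$ such that for all $(x,y)\in R$, $a\in A$: $x\Rightarrow a$ iff $y\Rightarrow a$; if $x\xrightarrow{a}x'$ then $y\xrightarrow{a}y'$ with $(x',y')\in R$; if $y\xrightarrow{a}y'$ then $x\xrightarrow{a}x'$ with $(x',y')\in R$. A bisimulation equivalence is a bisimulation on $X$ that is an equivalence relation. $\ker(j)=\{(x,x')\mid j(x)=j(x')\}$. The rerouting of $X$ by $(i,j)$ is the prechart $X[i,j]=(U,P(j)\circ\langle o,\partial\rangle\circ i)$, i.e. for $u\in U$: outputs of $u$ are as in $X$, and $\partial'(u)(a)=j[\partial(u)(a)]$. -}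

module Defs where

open import Data.Bool using (Bool; true)
open import Data.List using (List; map)
open import Data.List.Membership.Propositional using (_∈_)
open import Data.Product using (Σ; _×_; ∃-syntax; _,_; proj₁)
open import Relation.Binary.PropositionalEquality using (_≡_)
open import Function using (_⇔_)
open import Relation.Binary.Structures using (IsEquivalence)

-- A prechart over the action set A with carrier X:
-- o : X → 2^A  and  ∂ : X → P_ω(X)^A, finite subsets represented by lists
-- (membership ∈ is what matters; duplicates/order are irrelevant).
record Prechart (A : Set) (X : Set) : Set where
  field
    o : X → A → Bool
    ∂ : X → A → List X

module _ {A : Set} where
  open Prechart

  _⊢_⇒_ : {X : Set} → Prechart A X → X → A → Set
  c ⊢ x ⇒ a = o c x a ≡ true

  _⊢_─[_]→_ : {X : Set} → Prechart A X → X → A → X → Set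
  c ⊢ x ─[ a ]→ y = y ∈ ∂ c x a

  IsBisimulation : {X Y : Set} → Prechart A X → Prechart A Y → (X → Y → Set) → Set
  IsBisimulation {X} {Y} cX cY R =
    ∀ (x : X) (y : Y) → R x y → ∀ (a : A) →
        ((cX ⊢ x ⇒ a) ⇔ (cY ⊢ y ⇒ a))
      × (∀ x' → cX ⊢ x ─[ a ]→ x' → ∃[ y' ] (cY ⊢ y ─[ a ]→ y' × R x' y'))
      × (∀ y' → cY ⊢ y ─[ a ]→ y' → ∃[ x' ] (cX ⊢ x ─[ a ]→ x' × R x' y'))

  IsBisimulationEquivalence : {X : Set} → Prechart A X → (X → X → Set) → Set
  IsBisimulationEquivalence c R = IsBisimulation c c R × IsEquivalence R

  reroute : {X U : Set} → Prechart A X → (U → X) → (X → U) → Prechart A U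
  o (reroute c i j) u = o c (i u)
  ∂ (reroute c i j) u a = map j (∂ c (i u) a)

-- subsets of X as predicates; U = Σ X P with inclusion i = proj₁
Sub : (X : Set) → (X → Set) → Set
Sub X P = Σ X P

incl : {X : Set} {P : X → Set} → Sub X P → X
incl = proj₁

{-# OPTIONS --safe #-}
module Submission where

open import Defs
open import Data.Nat using (ℕ)
open import Data.Fin using (Fin)
open import Data.Product using (_,_; _×_; ∃-syntax)
open import Data.List.Membership.Propositional.Properties using (∈-map⁺; ∈-map⁻)
open import Relation.Binary.Definitions using (Transitive)
open import Relation.Binary.PropositionalEquality using (_≡_; refl; sym)
open import Relation.Binary.Structures using (IsEquivalence)

-- Rerouting replaces each successor y by j y, which is harmless as long as
-- R relates y to i (j y): transitivity then repairs every matching step of R.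
reroute-isBisimulation : ∀ {A X U : Set} (c : Prechart A X) (R : X → X → Set)
  (i : U → X) (j : X → U) →
  IsBisimulation c c R → Transitive R → (∀ y → R y (i (j y))) →
  IsBisimulation c (reroute c i j) (λ x u → R x (i u))
reroute-isBisimulation c R i j bisim trans y∼ij x u x∼iu a
  with bisim x (i u) x∼iu a
... | outputs , forth , back = outputs , forth′ , back′
  where
  forth′ : ∀ x′ → c ⊢ x ─[ a ]→ x′ →
    ∃[ v ] (reroute c i j ⊢ u ─[ a ]→ v × R x′ (i v))
  forth′ x′ x→x′ with forth x′ x→x′
  ... | y′ , iu→y′ , x′∼y′ = j y′ , ∈-map⁺ j iu→y′ , trans x′∼y′ (y∼ij y′)

  back′ : ∀ v → reroute c i j ⊢ u ─[ a ]→ v →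
    ∃[ x′ ] (c ⊢ x ─[ a ]→ x′ × R x′ (i v))
  back′ _ u→v with ∈-map⁻ j u→v
  ... | y′ , iu→y′ , refl with back y′ iu→y′
  ... | x′ , x→x′ , x′∼y′ = x′ , x→x′ , trans x′∼y′ (y∼ij y′)

splitting-ker⇒∼-incl∘j : ∀ {X : Set} {P : X → Set} (R : X → X → Set)
  (j : X → Sub X P) → (∀ u → j (incl u) ≡ u) → (∀ x x′ → j x ≡ j x′ → R x x′) →
  ∀ y → R y (incl (j y))
splitting-ker⇒∼-incl∘j R j j∘incl ker y = ker y (incl (j y)) (sym (j∘incl (j y)))

lemma4p4 : (n : ℕ) (X : Set) (c : Prechart (Fin n) X) (R : X → X → Set)
    → IsBisimulationEquivalence c R
    → (P : X → Set) (j : X → Sub X P)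
    → (∀ (u : Sub X P) → j (incl u) ≡ u)
    → (∀ (x x' : X) → j x ≡ j x' → R x x')
    → IsBisimulation c (reroute c incl j) (λ x u → R x (incl u))
lemma4p4 n X c R (bisim , equiv) P j j∘incl ker =
  reroute-isBisimulation c R incl j bisim (IsEquivalence.trans equiv)
    (splitting-ker⇒∼-incl∘j R j j∘incl ker)
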